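{- For every integer $n \geq 3$ with $n \neq 5$, Left wins the Classic Variant of the Mixed Deletion Game played on the cycle $C_n$ regardless of which player moves first.
   Context: The Classic Variant of the Mixed Deletion Game is a two-player combinatorial game between Left and Right played on a finite simple undirected graph; players alternate turns. On her turn Left deletes one vertex together with all edges incident to it; on his turn Right deletes one edge. The game ends when a deletion creates an isolated vertex (a vertex of degree $0$), and the player whose deletion created an isolated vertex loses; thus a legal move is a deletion which does not create an isolated vertex, and a player with no legal move loses. $C_n$ denotes the cycle graph on $n$ vertices. -}

module Defs where

open import Data.Nat using (ℕ; suc; _≡ᵇ_)
open import Data.Fin using (Fin; toℕ)
open import Data.Fin.Properties using (_≟_)
open import Data.Bool using (Bool; true; false; _∧_; _∨_; not)
open import Data.Product using (Σ; _×_)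
open import Relation.Nullary.Decidable using (⌊_⌋)
open import Relation.Binary.PropositionalEquality using (_≡_)

-- A (sub)graph position on the vertex universe Fin n:
--   alive v  : vertex v is still present
--   adj u v  : the edge {u,v} is still present (kept symmetric by all moves)
record Graph (n : ℕ) : Set where
  constructor mkGraph
  field
    alive : Fin n → Bool
    adj   : Fin n → Fin n → Bool
open Graph public

_=ᶠ_ : {n : ℕ} → Fin n → Fin n → Bool
u =ᶠ v = ⌊ u ≟ v ⌋

deleteVertex : {n : ℕ} → Graph n → Fin n → Graph n
deleteVertex g v = mkGraph
  (λ x → alive g x ∧ not (x =ᶠ v))
  (λ x y → adj g x y ∧ not (x =ᶠ v) ∧ not (y =ᶠ v))

deleteEdge : {n : ℕ} → Graph n → Fin n → Fin n → Graph n
deleteEdge g u v = mkGraph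
  (alive g)
  (λ x y → adj g x y ∧ not ((x =ᶠ u ∧ y =ᶠ v) ∨ (x =ᶠ v ∧ y =ᶠ u)))

NoIsolated : {n : ℕ} → Graph n → Set
NoIsolated {n} g = (x : Fin n) → alive g x ≡ true → Σ (Fin n) (λ y → adj g x y ≡ true)

-- A legal move is a deletion that does not create an isolated vertex.
-- A player with no legal move loses (equivalently: the player creating an
-- isolated vertex loses).  Since the game is finite, the inductive
-- definitions below capture exactly the winning positions.
mutual
  data LeftWinsLeftToMove {n : ℕ} (g : Graph n) : Set where
    leftMove : (v : Fin n) → alive g v ≡ true
             → NoIsolated (deleteVertex g v)
             → LeftWinsRightToMove (deleteVertex g v)
             → LeftWinsLeftToMove g

  data LeftWinsRightToMove {n : ℕ} (g : Graph n) : Set where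
    rightMoves : ((u v : Fin n) → adj g u v ≡ true
                   → NoIsolated (deleteEdge g u v)
                   → LeftWinsLeftToMove (deleteEdge g u v))
               → LeftWinsRightToMove g

cycleAdj : (n : ℕ) → Fin n → Fin n → Bool
cycleAdj n i j =
  (suc (toℕ i) ≡ᵇ toℕ j) ∨ (suc (toℕ j) ≡ᵇ toℕ i)
  ∨ ((toℕ i ≡ᵇ 0) ∧ (suc (toℕ j) ≡ᵇ n))
  ∨ ((toℕ j ≡ᵇ 0) ∧ (suc (toℕ i) ≡ᵇ n))

C : (n : ℕ) → Graph n
C n = mkGraph (λ _ → true) (cycleAdj n)

-- After the first move every position is a linear forest without isolated vertices, certified
-- by a ranking into ℕ under which each edge joins consecutive numbers.  Call a vertex internal
-- if it has two distinct neighbours.  Right may only cut an edge whose endpoints are both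
-- internal, so Left is safe with Right to move when no two internal vertices are adjacent, or
-- when there are three of them (a cut spoils at most two, leaving Left an internal vertex).
-- Whenever some vertex is internal, Left can move into such a position: she deletes a leaf next
-- to an internal vertex or, if the internal vertices are exactly three consecutive ones, the
-- middle one.  From C_n, Right's first cut leaves a path with internal vertices, and Left's first
-- move leaves the path on n - 1 vertices, which is such a position unless n - 1 = 4.

module Submission where

open import Defs
open import Data.Bool using (Bool; true; false; _∧_; _∨_; not; T)
open import Data.Bool.Properties
  using (∧-conicalˡ; ∧-conicalʳ; ∨-conicalˡ; ∨-conicalʳ; not-injective)
  renaming (_≟_ to _≟ᵇ_)
open import Data.Unit using (tt)
open import Data.Fin using (Fin; toℕ; fromℕ; inject₁) renaming (suc to fsuc)
open import Data.Fin.Patterns using (0F; 1F; 2F; 3F; 4F)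
open import Data.Fin.Properties
  using (_≟_; any?; all?; toℕ-injective; toℕ<n; toℕ-fromℕ; toℕ-inject₁; toℕ-inject₁-≢)
open import Data.Nat using (ℕ; zero; suc; _+_; _∸_; _≤_; _<_; _≤?_; _≡ᵇ_; z≤n; s≤s)
import Data.Nat.Properties as ℕ
open import Data.Product using (Σ; _×_; _,_; proj₁; proj₂)
open import Data.Sum using (_⊎_; inj₁; inj₂; map₂) renaming (swap to ⊎-swap)
open import Function using (_∘_; _$_)
open import Relation.Nullary using (¬_; Dec; yes; no; contradiction)
open import Relation.Nullary.Decidable using (isYes≗does; dec-true; dec-false; map′; ¬?; _×-dec_; toWitness)
open import Relation.Binary.PropositionalEquality

-- Adj and Internal are records so that the graph in their types can be recovered by
-- unification, which fails for adj g x y ≡ true once g is a deletion.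
record Adj {n} (g : Graph n) (x y : Fin n) : Set where
  constructor adjacent
  field present : adj g x y ≡ true

adj? : ∀ {n} (g : Graph n) x y → Dec (Adj g x y)
adj? g x y = map′ adjacent Adj.present (adj g x y ≟ᵇ true)

_⊆_ : ∀ {n} → Graph n → Graph n → Set
h ⊆ g = ∀ {x y} → Adj h x y → Adj g x y

=ᶠ-refl : ∀ {n} (x : Fin n) → (x =ᶠ x) ≡ true
=ᶠ-refl x = trans (isYes≗does (x ≟ x)) (dec-true (x ≟ x) refl)

≢⇒=ᶠ-false : ∀ {n} {x y : Fin n} → x ≢ y → (x =ᶠ y) ≡ false
≢⇒=ᶠ-false {x = x} {y} x≢y = trans (isYes≗does (x ≟ y)) (dec-false (x ≟ y) x≢y)

not-=ᶠ⇒≢ : ∀ {n} {x y : Fin n} → not (x =ᶠ y) ≡ true → x ≢ y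
not-=ᶠ⇒≢ {x = x} e refl with () ← subst (λ b → not b ≡ true) (=ᶠ-refl x) e

≢⇒∧-=ᶠ-false : ∀ {n} {x y u v : Fin n} → ¬ (x ≡ u × y ≡ v) → (x =ᶠ u ∧ y =ᶠ v) ≡ false
≢⇒∧-=ᶠ-false {x = x} {y} {u} {v} ne with x ≟ u | y ≟ v
... | yes refl | yes refl = contradiction (refl , refl) ne
... | yes _    | no _     = refl
... | no _     | _        = refl

∧-=ᶠ-false⇒≢ : ∀ {n} {x y u v : Fin n} → (x =ᶠ u ∧ y =ᶠ v) ≡ false → ¬ (x ≡ u × y ≡ v)
∧-=ᶠ-false⇒≢ {x = x} {y} e (refl , refl) with () ← trans (sym (cong₂ _∧_ (=ᶠ-refl x) (=ᶠ-refl y))) e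

module _ {n : ℕ} (g : Graph n) where

  Adj-deleteVertex⁻ : ∀ {t x y} → Adj (deleteVertex g t) x y → Adj g x y × x ≢ t × y ≢ t
  Adj-deleteVertex⁻ {t} {x} {y} (adjacent e) =
    adjacent (∧-conicalˡ _ _ e) , not-=ᶠ⇒≢ (∧-conicalˡ _ _ ends) , not-=ᶠ⇒≢ (∧-conicalʳ _ _ ends)
    where ends = ∧-conicalʳ (adj g x y) _ e

  Adj-deleteVertex⁺ : ∀ {t x y} → Adj g x y → x ≢ t → y ≢ t → Adj (deleteVertex g t) x y
  Adj-deleteVertex⁺ (adjacent e) x≢t y≢t = adjacent $
    cong₂ _∧_ e (cong₂ _∧_ (cong not (≢⇒=ᶠ-false x≢t)) (cong not (≢⇒=ᶠ-false y≢t)))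

  alive-deleteVertex⁻ : ∀ {t x} → alive (deleteVertex g t) x ≡ true → alive g x ≡ true × x ≢ t
  alive-deleteVertex⁻ {t} {x} a = ∧-conicalˡ _ _ a , not-=ᶠ⇒≢ (∧-conicalʳ (alive g x) _ a)

  Adj-deleteEdge⁻ : ∀ {u v x y} → Adj (deleteEdge g u v) x y
                  → Adj g x y × ¬ (x ≡ u × y ≡ v) × ¬ (x ≡ v × y ≡ u)
  Adj-deleteEdge⁻ {u} {v} {x} {y} (adjacent e) =
    adjacent (∧-conicalˡ _ _ e) , ∧-=ᶠ-false⇒≢ (∨-conicalˡ _ _ cut) , ∧-=ᶠ-false⇒≢ (∨-conicalʳ _ _ cut)
    where cut = not-injective {y = false} (∧-conicalʳ (adj g x y) _ e)

  Adj-deleteEdge⁺ : ∀ {u v x y} → Adj g x y → ¬ (x ≡ u × y ≡ v) → ¬ (x ≡ v × y ≡ u)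
                  → Adj (deleteEdge g u v) x y
  Adj-deleteEdge⁺ (adjacent e) ne₁ ne₂ = adjacent $
    cong₂ _∧_ e (cong not (cong₂ _∨_ (≢⇒∧-=ᶠ-false ne₁) (≢⇒∧-=ᶠ-false ne₂)))

  deleteVertex-⊆ : ∀ {t} → deleteVertex g t ⊆ g
  deleteVertex-⊆ e = proj₁ (Adj-deleteVertex⁻ e)

  deleteEdge-⊆ : ∀ {u v} → deleteEdge g u v ⊆ g
  deleteEdge-⊆ e = proj₁ (Adj-deleteEdge⁻ e)

  deleteEdge-comm-⊆ : ∀ {u v} → deleteEdge g u v ⊆ deleteEdge g v u
  deleteEdge-comm-⊆ e = let (e′ , ne₁ , ne₂) = Adj-deleteEdge⁻ e in Adj-deleteEdge⁺ e′ ne₂ ne₁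

Symmetric : ∀ {n} → Graph n → Set
Symmetric g = ∀ {x y} → Adj g x y → Adj g y x

EdgesAlive : ∀ {n} → Graph n → Set
EdgesAlive g = ∀ {x y} → Adj g x y → alive g x ≡ true

module _ {n : ℕ} {g : Graph n} where

  deleteVertex-symmetric : ∀ {t} → Symmetric g → Symmetric (deleteVertex g t)
  deleteVertex-symmetric symm e =
    let (e′ , x≢t , y≢t) = Adj-deleteVertex⁻ g e in Adj-deleteVertex⁺ g (symm e′) y≢t x≢t

  deleteEdge-symmetric : ∀ {u v} → Symmetric g → Symmetric (deleteEdge g u v)
  deleteEdge-symmetric symm e =
    let (e′ , ne₁ , ne₂) = Adj-deleteEdge⁻ g e
    in  Adj-deleteEdge⁺ g (symm e′) (λ (p , q) → ne₂ (q , p)) (λ (p , q) → ne₁ (q , p))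

  deleteVertex-edgesAlive : ∀ {t} → EdgesAlive g → EdgesAlive (deleteVertex g t)
  deleteVertex-edgesAlive al e =
    let (e′ , x≢t , _) = Adj-deleteVertex⁻ g e in cong₂ _∧_ (al e′) (cong not (≢⇒=ᶠ-false x≢t))

  deleteEdge-edgesAlive : ∀ {u v} → EdgesAlive g → EdgesAlive (deleteEdge g u v)
  deleteEdge-edgesAlive al e = al (deleteEdge-⊆ g e)

record Internal {n} (g : Graph n) (x : Fin n) : Set where
  constructor internal
  field
    {left right}   : Fin n
    adjacent-left  : Adj g x left
    adjacent-right : Adj g x right
    left≢right     : left ≢ right

internal? : ∀ {n} (g : Graph n) x → Dec (Internal g x)
internal? g x = map′
  (λ (_ , _ , ey , ez , y≢z) → internal ey ez y≢z)
  (λ (internal ey ez y≢z) → _ , _ , ey , ez , y≢z)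
  (any? λ y → any? λ z → adj? g x y ×-dec adj? g x z ×-dec ¬? (y ≟ z))

module _ {n : ℕ} {g : Graph n} where

  unique-neighbour : ∀ {t a b} → ¬ Internal g t → Adj g t a → Adj g t b → b ≡ a
  unique-neighbour {a = a} {b} ¬it ea eb with b ≟ a
  ... | yes b≡a = b≡a
  ... | no b≢a  = contradiction (internal ea eb (b≢a ∘ sym)) ¬it

  other-neighbour : ∀ {x} → Internal g x → (w : Fin n) → Σ (Fin n) λ t → Adj g x t × t ≢ w
  other-neighbour (internal {y} {z} ey ez y≢z) w with y ≟ w
  ... | yes refl = z , ez , λ z≡y → y≢z (sym z≡y)
  ... | no y≢w   = y , ey , y≢w

  Internal-deleteVertex⁻ : ∀ {t x} → Internal (deleteVertex g t) x → Internal g x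
  Internal-deleteVertex⁻ (internal ey ez y≢z) = internal (deleteVertex-⊆ g ey) (deleteVertex-⊆ g ez) y≢z

  Internal-deleteVertex-≢ : ∀ {t x} → Internal (deleteVertex g t) x → x ≢ t
  Internal-deleteVertex-≢ (internal ey _ _) = proj₁ (proj₂ (Adj-deleteVertex⁻ g ey))

  Internal-deleteVertex⁺ : ∀ {t x} → Internal g x → ¬ Adj g x t → x ≢ t → Internal (deleteVertex g t) x
  Internal-deleteVertex⁺ (internal ey ez y≢z) ¬ext x≢t =
    internal (Adj-deleteVertex⁺ g ey x≢t (λ { refl → ¬ext ey }))
             (Adj-deleteVertex⁺ g ez x≢t (λ { refl → ¬ext ez })) y≢z

  Internal-deleteEdge⁺ : ∀ {u v x} → Internal g x → x ≢ u → x ≢ v → Internal (deleteEdge g u v) x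
  Internal-deleteEdge⁺ (internal ey ez y≢z) x≢u x≢v =
    internal (Adj-deleteEdge⁺ g ey (x≢u ∘ proj₁) (x≢v ∘ proj₁))
             (Adj-deleteEdge⁺ g ez (x≢u ∘ proj₁) (x≢v ∘ proj₁)) y≢z

  deleteVertex-legal : ∀ {t} → Symmetric g → NoIsolated g → (∀ {y} → Adj g t y → Internal g y)
                     → NoIsolated (deleteVertex g t)
  deleteVertex-legal {t} symm noIso nbrs x alive-x with alive-deleteVertex⁻ g alive-x
  ... | alive-x′ , x≢t with noIso x alive-x′
  ... | w , e with w ≟ t
  ... | no w≢t = w , Adj.present (Adj-deleteVertex⁺ g (adjacent e) x≢t w≢t)
  ... | yes refl with other-neighbour (nbrs (symm (adjacent e))) t
  ... | s , es , s≢t = s , Adj.present (Adj-deleteVertex⁺ g es x≢t s≢t)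

ThreeDistinct : ∀ {n} → (Fin n → Set) → Set
ThreeDistinct {n} P = Σ (Fin n) λ a → Σ (Fin n) λ b → Σ (Fin n) λ c →
  P a × P b × P c × a ≢ b × a ≢ c × b ≢ c

module _ {n : ℕ} {P : Fin n → Set} where

  threeDistinct? : (∀ x → Dec (P x)) → Dec (ThreeDistinct P)
  threeDistinct? P? =
    any? λ a → any? λ b → any? λ c →
      P? a ×-dec P? b ×-dec P? c ×-dec ¬? (a ≟ b) ×-dec ¬? (a ≟ c) ×-dec ¬? (b ≟ c)

  threeDistinct-map : ∀ {Q : Fin n → Set} → (∀ {x} → P x → Q x) → ThreeDistinct P → ThreeDistinct Q
  threeDistinct-map f (a , b , c , pa , pb , pc , ds) = a , b , c , f pa , f pb , f pc , ds

  threeDistinct-avoiding : ThreeDistinct P → (u v : Fin n) → Σ (Fin n) λ x → P x × x ≢ u × x ≢ v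
  threeDistinct-avoiding (a , b , c , pa , pb , pc , a≢b , a≢c , b≢c) u v with a ≟ u | a ≟ v
  ... | no a≢u | no a≢v = a , pa , a≢u , a≢v
  ... | yes refl | _ with b ≟ v
  ...   | no b≢v  = b , pb , a≢b ∘ sym , b≢v
  ...   | yes refl = c , pc , a≢c ∘ sym , b≢c ∘ sym
  threeDistinct-avoiding (a , b , c , pa , pb , pc , a≢b , a≢c , b≢c) u v | no _ | yes refl with b ≟ u
  ...   | no b≢u  = b , pb , b≢u , a≢b ∘ sym
  ...   | yes refl = c , pc , b≢c ∘ sym , a≢c ∘ sym

  ¬threeDistinct⇒pair : ¬ ThreeDistinct P → ∀ {p q} → P p → P q → p ≢ q → ∀ {r} → P r → r ≡ p ⊎ r ≡ q
  ¬threeDistinct⇒pair ¬three {p} {q} pp pq p≢q {r} pr with r ≟ p | r ≟ q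
  ... | yes r≡p | _       = inj₁ r≡p
  ... | no _    | yes r≡q = inj₂ r≡q
  ... | no r≢p  | no r≢q  = contradiction (r , p , q , pr , pp , pq , r≢p , r≢q , p≢q) ¬three

record PathRanking {n} (g : Graph n) : Set where
  field
    rank           : Fin n → ℕ
    rank-injective : ∀ {x y} → rank x ≡ rank y → x ≡ y
    rank-adjacent  : ∀ {x y} → Adj g x y → rank y ≡ suc (rank x) ⊎ rank x ≡ suc (rank y)

pathRanking-⊆ : ∀ {n} {g h : Graph n} → h ⊆ g → PathRanking g → PathRanking h
pathRanking-⊆ h⊆g R = record
  { rank = rank ; rank-injective = rank-injective ; rank-adjacent = rank-adjacent ∘ h⊆g }
  where open PathRanking R

module PathRankingProperties {n} {g : Graph n} (R : PathRanking g) where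
  open PathRanking R

  irreflexive : ∀ {x} → ¬ Adj g x x
  irreflexive {x} e with rank-adjacent e
  ... | inj₁ r≡1+r = ℕ.1+n≢n (sym r≡1+r)
  ... | inj₂ r≡1+r = ℕ.1+n≢n (sym r≡1+r)

  at-most-two-neighbours : ∀ {x y z w} → Adj g x y → Adj g x z → y ≢ z → Adj g x w → w ≡ y ⊎ w ≡ z
  at-most-two-neighbours ey ez y≢z ew
    with rank-adjacent ey | rank-adjacent ez | rank-adjacent ew
  ... | inj₁ ry | inj₁ rz | _ = contradiction (rank-injective (trans ry (sym rz))) y≢z
  ... | inj₂ ry | inj₂ rz | _ = contradiction (rank-injective (ℕ.suc-injective (trans (sym ry) rz))) y≢z
  ... | inj₁ ry | inj₂ _  | inj₁ rw = inj₁ (rank-injective (trans rw (sym ry)))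
  ... | inj₁ _  | inj₂ rz | inj₂ rw = inj₂ (rank-injective (ℕ.suc-injective (trans (sym rw) rz)))
  ... | inj₂ _  | inj₁ rz | inj₁ rw = inj₂ (rank-injective (trans rw (sym rz)))
  ... | inj₂ ry | inj₁ _  | inj₂ rw = inj₁ (rank-injective (ℕ.suc-injective (trans (sym rw) ry)))

  lower-neighbour : ∀ {x} → Internal g x → Σ (Fin n) λ y → Adj g x y × rank x ≡ suc (rank y)
  lower-neighbour (internal {y} {z} ey ez y≢z) with rank-adjacent ey | rank-adjacent ez
  ... | inj₂ ry | _       = y , ey , ry
  ... | inj₁ _  | inj₂ rz = z , ez , rz
  ... | inj₁ ry | inj₁ rz = contradiction (rank-injective (trans ry (sym rz))) y≢z

  Internal-deleteVertex⇒¬Adj : ∀ {t x} → Internal (deleteVertex g t) x → ¬ Adj g x t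
  Internal-deleteVertex⇒¬Adj (internal ey ez y≢z) ext
    with Adj-deleteVertex⁻ g ey | Adj-deleteVertex⁻ g ez
  ... | ey′ , _ , y≢t | ez′ , _ , z≢t with at-most-two-neighbours ey′ ez′ y≢z ext
  ... | inj₁ t≡y = y≢t (sym t≡y)
  ... | inj₂ t≡z = z≢t (sym t≡z)

record LinearForest {n} (g : Graph n) : Set where
  field
    ranking    : PathRanking g
    symmetric  : Symmetric g
    edgesAlive : EdgesAlive g
    noIsolated : NoIsolated g

module _ {n : ℕ} {g : Graph n} (F : LinearForest g) where
  open LinearForest F

  linearForest-deleteVertex : ∀ {t} → NoIsolated (deleteVertex g t) → LinearForest (deleteVertex g t)
  linearForest-deleteVertex legal = record
    { ranking    = pathRanking-⊆ (deleteVertex-⊆ g) ranking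
    ; symmetric  = deleteVertex-symmetric symmetric
    ; edgesAlive = deleteVertex-edgesAlive edgesAlive
    ; noIsolated = legal
    }

  linearForest-deleteEdge : ∀ {u v} → NoIsolated (deleteEdge g u v) → LinearForest (deleteEdge g u v)
  linearForest-deleteEdge legal = record
    { ranking    = pathRanking-⊆ (deleteEdge-⊆ g) ranking
    ; symmetric  = deleteEdge-symmetric symmetric
    ; edgesAlive = deleteEdge-edgesAlive edgesAlive
    ; noIsolated = legal
    }

InternalIndependent : ∀ {n} → Graph n → Set
InternalIndependent g = ∀ {p q} → Internal g p → Internal g q → ¬ Adj g p q

GoodForLeft : ∀ {n} → Graph n → Set
GoodForLeft g = ThreeDistinct (Internal g) ⊎ InternalIndependent g

GoodMove : ∀ {n} → Graph n → Set
GoodMove {n} g = Σ (Fin n) λ v →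
  alive g v ≡ true × NoIsolated (deleteVertex g v) × GoodForLeft (deleteVertex g v)

module LeftStrategy {n} {g : Graph n} (F : LinearForest g) where
  open LinearForest F
  open PathRanking ranking
  open PathRankingProperties ranking

  InternalBesides : Fin n → Fin n → Set
  InternalBesides a x = Internal g x × x ≢ a

  internalBesides? : ∀ a x → Dec (InternalBesides a x)
  internalBesides? a x = internal? g x ×-dec ¬? (x ≟ a)

  leaf-next-to-internal : ∀ m {x} → rank x ≡ m → Internal g x
                        → Σ (Fin n) λ v → Σ (Fin n) λ a → Adj g v a × ¬ Internal g v × Internal g a
  leaf-next-to-internal m {x} rx ix with lower-neighbour ix
  ... | y , exy , rx≡1+ry with internal? g y
  ... | no ¬iy = y , x , symmetric exy , ¬iy , ix
  ... | yes iy with m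
  ...   | zero   = contradiction (trans (sym rx) rx≡1+ry) ℕ.0≢1+n
  ...   | suc m′ = leaf-next-to-internal m′ (ℕ.suc-injective (trans (sym rx≡1+ry) rx)) iy

  module _ {t s} (ets : Adj g t s) (¬it : ¬ Internal g t) (is : Internal g s) where

    deleteLeaf-legal : NoIsolated (deleteVertex g t)
    deleteLeaf-legal =
      deleteVertex-legal symmetric noIsolated λ ety →
        subst (Internal g) (sym (unique-neighbour ¬it ets ety)) is

    leafMove-three : ThreeDistinct (InternalBesides s) → GoodMove g
    leafMove-three three = t , edgesAlive ets , deleteLeaf-legal , inj₁ (threeDistinct-map survives three)
      where
        survives : ∀ {x} → InternalBesides s x → Internal (deleteVertex g t) x
        survives (ix , x≢s) =
          Internal-deleteVertex⁺ ix (λ ext → x≢s (unique-neighbour ¬it ets (symmetric ext)))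
                                    (λ { refl → ¬it ix })

    leafMove-independent : (∀ {p q} → Internal g p → Internal g q → p ≢ s → q ≢ s → ¬ Adj g p q)
                         → GoodMove g
    leafMove-independent indep = t , edgesAlive ets , deleteLeaf-legal , inj₂ independent
      where
        ≢s : ∀ {p} → Internal (deleteVertex g t) p → p ≢ s
        ≢s ip refl = Internal-deleteVertex⇒¬Adj ip (symmetric ets)
        independent : InternalIndependent (deleteVertex g t)
        independent ip iq e =
          indep (Internal-deleteVertex⁻ ip) (Internal-deleteVertex⁻ iq) (≢s ip) (≢s iq) (deleteVertex-⊆ g e)

  centreMove : ∀ {a s b} → Adj g a s → Adj g s b → a ≢ b → Internal g a → Internal g b
             → (∀ {r} → Internal g r → r ≡ a ⊎ r ≡ s ⊎ r ≡ b) → GoodMove g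
  centreMove {a} {s} {b} eas esb a≢b ia ib cover =
    s , edgesAlive esb , deleteVertex-legal symmetric noIsolated neighbours-internal ,
    inj₂ λ ip _ _ → no-internal ip
    where
      neighbours-internal : ∀ {y} → Adj g s y → Internal g y
      neighbours-internal esy with at-most-two-neighbours (symmetric eas) esb a≢b esy
      ... | inj₁ refl = ia
      ... | inj₂ refl = ib
      no-internal : ∀ {p} → ¬ Internal (deleteVertex g s) p
      no-internal {p} ip with cover {p} (Internal-deleteVertex⁻ ip)
      ... | inj₁ refl        = Internal-deleteVertex⇒¬Adj ip eas
      ... | inj₂ (inj₁ refl) = Internal-deleteVertex-≢ {g = g} ip refl
      ... | inj₂ (inj₂ refl) = Internal-deleteVertex⇒¬Adj ip (symmetric esb)

  pairMove : ∀ {a p q} → Internal g a → Internal g p → Internal g q → p ≢ a → q ≢ a → Adj g p q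
           → (∀ {r} → Internal g r → r ≡ a ⊎ r ≡ p ⊎ r ≡ q) → GoodMove g
  pairMove {a} {p} {q} ia ip iq p≢a q≢a epq cover with any? (λ c → adj? g a c ×-dec internal? g c)
  ... | yes (c , eac , ic) with cover ic
  ...   | inj₁ refl        = contradiction eac irreflexive
  ...   | inj₂ (inj₁ refl) = centreMove eac epq (q≢a ∘ sym) ia iq cover
  ...   | inj₂ (inj₂ refl) = centreMove eac (symmetric epq) (p≢a ∘ sym) ia ip (map₂ ⊎-swap ∘ cover)
  pairMove {a} {p} {q} ia ip iq p≢a q≢a epq cover | no ¬internal-neighbour
    with other-neighbour ip q
  ... | t , ept , t≢q = leafMove-independent (symmetric ept) ¬it ip independent
    where
      ¬it : ¬ Internal g t
      ¬it it with cover it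
      ... | inj₁ refl        = ¬internal-neighbour (p , symmetric ept , ip)
      ... | inj₂ (inj₁ refl) = irreflexive ept
      ... | inj₂ (inj₂ refl) = t≢q refl
      independent : ∀ {r r′} → Internal g r → Internal g r′ → r ≢ p → r′ ≢ p → ¬ Adj g r r′
      independent ir ir′ r≢p r′≢p e with cover ir | cover ir′
      ... | inj₁ refl        | _                = ¬internal-neighbour (_ , e , ir′)
      ... | _                | inj₁ refl        = ¬internal-neighbour (_ , symmetric e , ir)
      ... | inj₂ (inj₁ refl) | _                = r≢p refl
      ... | _                | inj₂ (inj₁ refl) = r′≢p refl
      ... | inj₂ (inj₂ refl) | inj₂ (inj₂ refl) = irreflexive e

  goodMove : Σ (Fin n) (Internal g) → GoodMove g
  goodMove (x , ix) with leaf-next-to-internal (rank x) refl ix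
  ... | v , a , eva , ¬iv , ia with threeDistinct? (internalBesides? a)
  ... | yes three = leafMove-three eva ¬iv ia three
  ... | no ¬three
    with any? (λ p → any? λ q → internalBesides? a p ×-dec internalBesides? a q ×-dec adj? g p q)
  ... | no ¬pair =
        leafMove-independent eva ¬iv ia λ ip iq p≢a q≢a epq → ¬pair (_ , _ , (ip , p≢a) , (iq , q≢a) , epq)
  ... | yes (p , q , (ip , p≢a) , (iq , q≢a) , epq) = pairMove ia ip iq p≢a q≢a epq cover
    where
      cover : ∀ {r} → Internal g r → r ≡ a ⊎ r ≡ p ⊎ r ≡ q
      cover {r} ir with r ≟ a
      ... | yes r≡a = inj₁ r≡a
      ... | no r≢a  =
        inj₂ (¬threeDistinct⇒pair ¬three (ip , p≢a) (iq , q≢a) (λ { refl → irreflexive epq }) (ir , r≢a))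

module _ {n : ℕ} {g : Graph n} where

  threeInternal-deleteEdge : ∀ {u v} → ThreeDistinct (Internal g) → Σ (Fin n) (Internal (deleteEdge g u v))
  threeInternal-deleteEdge {u} {v} three with threeDistinct-avoiding three u v
  ... | x , ix , x≢u , x≢v = x , Internal-deleteEdge⁺ ix x≢u x≢v

  independent⇒¬legal : ∀ {u v} → Symmetric g → EdgesAlive g → InternalIndependent g → Adj g u v
                     → ¬ NoIsolated (deleteEdge g u v)
  independent⇒¬legal {u} {v} symm al independent euv legal
    with legal u (al euv) | legal v (al (symm euv))
  ... | _ , euw | _ , evw
    with Adj-deleteEdge⁻ g (adjacent euw) | Adj-deleteEdge⁻ g (adjacent evw)
  ... | euw′ , ¬uv , _ | evw′ , _ , ¬vu =
    independent (internal euv euw′ λ v≡w → ¬uv (refl , sym v≡w))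
                (internal (symm euv) evw′ λ u≡w → ¬vu (refl , sym u≡w)) euv

sumᶠ : ∀ {n} → (Fin n → ℕ) → ℕ
sumᶠ {zero}  f = 0
sumᶠ {suc n} f = f 0F + sumᶠ (f ∘ fsuc)

sumᶠ-mono-≤ : ∀ {n} {f h : Fin n → ℕ} → (∀ i → f i ≤ h i) → sumᶠ f ≤ sumᶠ h
sumᶠ-mono-≤ {zero}  f≤h = z≤n
sumᶠ-mono-≤ {suc n} f≤h = ℕ.+-mono-≤ (f≤h 0F) (sumᶠ-mono-≤ (f≤h ∘ fsuc))

sumᶠ-mono-< : ∀ {n} {f h : Fin n → ℕ} → (∀ i → f i ≤ h i) → ∀ j → f j < h j → sumᶠ f < sumᶠ h
sumᶠ-mono-< f≤h 0F       fj<hj = ℕ.+-mono-<-≤ fj<hj (sumᶠ-mono-≤ (f≤h ∘ fsuc))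
sumᶠ-mono-< f≤h (fsuc j) fj<hj = ℕ.+-mono-≤-< (f≤h 0F) (sumᶠ-mono-< (f≤h ∘ fsuc) j fj<hj)

fromBool : Bool → ℕ
fromBool true  = 1
fromBool false = 0

fromBool-mono-≤ : ∀ {a b} → (a ≡ true → b ≡ true) → fromBool a ≤ fromBool b
fromBool-mono-≤ {false} _   = z≤n
fromBool-mono-≤ {true}  a⇒b rewrite a⇒b refl = ℕ.≤-refl

fromBool-< : ∀ {a b} → a ≢ true → b ≡ true → fromBool a < fromBool b
fromBool-< {false} _ refl = ℕ.0<1+n
fromBool-< {true}  a≢true _ = contradiction refl a≢true

edgeCount : ∀ {n} → Graph n → ℕ
edgeCount g = sumᶠ λ x → sumᶠ λ y → fromBool (adj g x y)

edgeCount-< : ∀ {n} {g h : Graph n} {x y} → h ⊆ g → Adj g x y → ¬ Adj h x y → edgeCount h < edgeCount g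
edgeCount-< {g = g} {h} {x} {y} h⊆g (adjacent e) ¬e =
  sumᶠ-mono-< (λ _ → sumᶠ-mono-≤ entry) x (sumᶠ-mono-< entry y (fromBool-< (¬e ∘ adjacent) e))
  where
    entry : ∀ {x} y → fromBool (adj h x y) ≤ fromBool (adj g x y)
    entry y = fromBool-mono-≤ (Adj.present ∘ h⊆g ∘ adjacent)

module _ {n : ℕ} {g : Graph n} where

  edgeCount-deleteVertex : ∀ {v} → NoIsolated g → alive g v ≡ true
                         → edgeCount (deleteVertex g v) < edgeCount g
  edgeCount-deleteVertex {v} noIso alive-v with noIso v alive-v
  ... | _ , evw =
    edgeCount-< (deleteVertex-⊆ g) (adjacent evw) λ e → proj₁ (proj₂ (Adj-deleteVertex⁻ g e)) refl

  edgeCount-deleteEdge : ∀ {u v} → Adj g u v → edgeCount (deleteEdge g u v) < edgeCount g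
  edgeCount-deleteEdge euv =
    edgeCount-< (deleteEdge-⊆ g) euv λ e → proj₁ (proj₂ (Adj-deleteEdge⁻ g e)) (refl , refl)

mutual
  leftWins : ∀ {n} k {g : Graph n} → edgeCount g < k → LinearForest g → Σ (Fin n) (Internal g)
           → LeftWinsLeftToMove g
  leftWins (suc k) bound F internal-vertex with LeftStrategy.goodMove F internal-vertex
  ... | v , alive-v , legal , good =
    leftMove v alive-v legal $ rightWins k
      (ℕ.<-≤-trans (edgeCount-deleteVertex (LinearForest.noIsolated F) alive-v) (ℕ.≤-pred bound))
      (linearForest-deleteVertex F legal) good

  rightWins : ∀ {n} k {g : Graph n} → edgeCount g < k → LinearForest g → GoodForLeft g
            → LeftWinsRightToMove g
  rightWins k {g} bound F (inj₁ three) = rightMoves λ u v e legal →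
    leftWins k (ℕ.<-trans (edgeCount-deleteEdge {g = g} (adjacent e)) bound)
      (linearForest-deleteEdge F legal) (threeInternal-deleteEdge three)
  rightWins k bound F (inj₂ independent) = rightMoves λ u v e legal →
    contradiction legal (independent⇒¬legal symmetric edgesAlive independent (adjacent e))
    where open LinearForest F

CycleStep : (n : ℕ) → Fin n → Fin n → Set
CycleStep n x y = suc (toℕ x) ≡ toℕ y ⊎ (suc (toℕ x) ≡ n × toℕ y ≡ 0)

≡ᵇ-true⇒≡ : ∀ {m k} → (m ≡ᵇ k) ≡ true → m ≡ k
≡ᵇ-true⇒≡ {m} {k} e = ℕ.≡ᵇ⇒≡ m k (subst T (sym e) tt)

≡⇒≡ᵇ-true : ∀ {m k} → m ≡ k → (m ≡ᵇ k) ≡ true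
≡⇒≡ᵇ-true {m} {k} m≡k with m ≡ᵇ k | ℕ.≡⇒≡ᵇ m k m≡k
... | true | _ = refl

∨-true⁻ : ∀ a b → a ∨ b ≡ true → a ≡ true ⊎ b ≡ true
∨-true⁻ true  _ _ = inj₁ refl
∨-true⁻ false _ e = inj₂ e

∨-trueˡ : ∀ {a b} → a ≡ true → a ∨ b ≡ true
∨-trueˡ refl = refl

∨-trueʳ : ∀ a {b} → b ≡ true → a ∨ b ≡ true
∨-trueʳ true  _ = refl
∨-trueʳ false e = e

cycleAdj⇒step : ∀ {n} {x y : Fin n} → cycleAdj n x y ≡ true → CycleStep n x y ⊎ CycleStep n y x
cycleAdj⇒step e with ∨-true⁻ _ _ e
... | inj₁ a = inj₁ (inj₁ (≡ᵇ-true⇒≡ a))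
... | inj₂ e′ with ∨-true⁻ _ _ e′
... | inj₁ b = inj₂ (inj₁ (≡ᵇ-true⇒≡ b))
... | inj₂ e″ with ∨-true⁻ _ _ e″
... | inj₁ c = inj₂ (inj₂ (≡ᵇ-true⇒≡ (∧-conicalʳ _ _ c) , ≡ᵇ-true⇒≡ (∧-conicalˡ _ _ c)))
... | inj₂ d = inj₁ (inj₂ (≡ᵇ-true⇒≡ (∧-conicalʳ _ _ d) , ≡ᵇ-true⇒≡ (∧-conicalˡ _ _ d)))

step⇒cycleAdj : ∀ {n} {x y : Fin n} → CycleStep n x y ⊎ CycleStep n y x → cycleAdj n x y ≡ true
step⇒cycleAdj {n} {x} {y} (inj₁ (inj₁ sx≡y)) = ∨-trueˡ (≡⇒≡ᵇ-true sx≡y)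
step⇒cycleAdj {n} {x} {y} (inj₂ (inj₁ sy≡x)) =
  ∨-trueʳ (suc (toℕ x) ≡ᵇ toℕ y) (∨-trueˡ (≡⇒≡ᵇ-true sy≡x))
step⇒cycleAdj {n} {x} {y} (inj₂ (inj₂ (sy≡n , x≡0))) =
  ∨-trueʳ (suc (toℕ x) ≡ᵇ toℕ y) $ ∨-trueʳ (suc (toℕ y) ≡ᵇ toℕ x) $
  ∨-trueˡ (cong₂ _∧_ (≡⇒≡ᵇ-true x≡0) (≡⇒≡ᵇ-true sy≡n))
step⇒cycleAdj {n} {x} {y} (inj₁ (inj₂ (sx≡n , y≡0))) =
  ∨-trueʳ (suc (toℕ x) ≡ᵇ toℕ y) $ ∨-trueʳ (suc (toℕ y) ≡ᵇ toℕ x) $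
  ∨-trueʳ ((toℕ x ≡ᵇ 0) ∧ (suc (toℕ y) ≡ᵇ n)) (cong₂ _∧_ (≡⇒≡ᵇ-true y≡0) (≡⇒≡ᵇ-true sx≡n))

C-symmetric : ∀ {n} → Symmetric (C n)
C-symmetric {x = x} {y} (adjacent e) = adjacent (step⇒cycleAdj (⊎-swap (cycleAdj⇒step {x = x} {y} e)))

cycleStep-predecessor-unique : ∀ {n} {p x q : Fin n} → CycleStep n p q → CycleStep n x q → x ≡ p
cycleStep-predecessor-unique (inj₁ sp≡q) (inj₁ sx≡q) =
  toℕ-injective (ℕ.suc-injective (trans sx≡q (sym sp≡q)))
cycleStep-predecessor-unique (inj₂ (sp≡n , _)) (inj₂ (sx≡n , _)) =
  toℕ-injective (ℕ.suc-injective (trans sx≡n (sym sp≡n)))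
cycleStep-predecessor-unique (inj₁ sp≡q) (inj₂ (_ , q≡0)) = contradiction (trans sp≡q q≡0) ℕ.1+n≢0
cycleStep-predecessor-unique (inj₂ (_ , q≡0)) (inj₁ sx≡q) = contradiction (trans sx≡q q≡0) ℕ.1+n≢0

-- offset n k x is the position of x on the path obtained by cutting C n just before k.
offset : ℕ → ℕ → ℕ → ℕ
offset n k x with k ≤? x
... | yes _ = x ∸ k
... | no _  = x + n ∸ k

offset-suc : ∀ n k x → k ≤ n → k ≢ suc x → offset n k (suc x) ≡ suc (offset n k x)
offset-suc n k x k≤n k≢1+x with k ≤? x | k ≤? suc x
... | yes k≤x | yes _    = ℕ.+-∸-assoc 1 k≤x
... | yes k≤x | no k≰1+x = contradiction (ℕ.m≤n⇒m≤1+n k≤x) k≰1+x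
... | no k≰x  | yes k≤1+x = contradiction (ℕ.≤-antisym k≤1+x (ℕ.≰⇒> k≰x)) k≢1+x
... | no _    | no _     = ℕ.+-∸-assoc 1 (ℕ.≤-trans k≤n (ℕ.m≤n+m n x))

offset-wrap : ∀ k x → k ≢ 0 → k ≤ x → offset (suc x) k 0 ≡ suc (offset (suc x) k x)
offset-wrap k x k≢0 k≤x with k ≤? 0 | k ≤? x
... | yes k≤0 | _       = contradiction (ℕ.n≤0⇒n≡0 k≤0) k≢0
... | no _    | yes k≤x′ = ℕ.+-∸-assoc 1 k≤x′
... | no _    | no k≰x  = contradiction k≤x k≰x

offset-injective : ∀ n k x y → k ≤ n → x < n → y < n → offset n k x ≡ offset n k y → x ≡ y
offset-injective n k x y k≤n x<n y<n e with k ≤? x | k ≤? y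
... | yes k≤x | yes k≤y = ℕ.∸-cancelʳ-≡ k≤x k≤y e
... | no _    | no _    = ℕ.+-cancelʳ-≡ n x y
      (ℕ.∸-cancelʳ-≡ (ℕ.≤-trans k≤n (ℕ.m≤n+m n x)) (ℕ.≤-trans k≤n (ℕ.m≤n+m n y)) e)
... | yes k≤x | no _    =
      contradiction e (ℕ.<⇒≢ (ℕ.<-≤-trans (ℕ.∸-monoˡ-< x<n k≤x) (ℕ.∸-monoˡ-≤ k (ℕ.m≤n+m n y))))
... | no _    | yes k≤y =
      contradiction (sym e) (ℕ.<⇒≢ (ℕ.<-≤-trans (ℕ.∸-monoˡ-< y<n k≤y) (ℕ.∸-monoˡ-≤ k (ℕ.m≤n+m n x))))

cycleStep-offset : ∀ {n} {p q x y : Fin n} → CycleStep n p q → CycleStep n x y → ¬ (x ≡ p × y ≡ q)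
                 → offset n (toℕ q) (toℕ y) ≡ suc (offset n (toℕ q) (toℕ x))
cycleStep-offset {n} {p} {q} {x} {y} pq (inj₁ sx≡y) ¬xy≡pq rewrite sym sx≡y =
  offset-suc n (toℕ q) (toℕ x) (ℕ.<⇒≤ (toℕ<n q)) q≢y
  where
    q≢y : toℕ q ≢ suc (toℕ x)
    q≢y q≡sx = ¬xy≡pq ( cycleStep-predecessor-unique pq (inj₁ (sym q≡sx))
                      , toℕ-injective (trans (sym sx≡y) (sym q≡sx)))
cycleStep-offset {n} {p} {q} {x} {y} pq (inj₂ (sx≡n , y≡0)) ¬xy≡pq rewrite y≡0 =
  subst (λ n′ → offset n′ (toℕ q) 0 ≡ suc (offset n′ (toℕ q) (toℕ x))) sx≡n $
    offset-wrap (toℕ q) (toℕ x) q≢0 (ℕ.≤-pred (subst (toℕ q <_) (sym sx≡n) (toℕ<n q)))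
  where
    q≢0 : toℕ q ≢ 0
    q≢0 q≡0 = ¬xy≡pq ( cycleStep-predecessor-unique pq (inj₂ (sx≡n , q≡0))
                      , toℕ-injective (trans y≡0 (sym q≡0)))

cycle-deleteStep-ranking : ∀ {n} {p q : Fin n} → CycleStep n p q → PathRanking (deleteEdge (C n) p q)
cycle-deleteStep-ranking {n} {p} {q} pq = record
  { rank           = λ x → offset n (toℕ q) (toℕ x)
  ; rank-injective = λ {x} {y} e →
      toℕ-injective (offset-injective n (toℕ q) (toℕ x) (toℕ y) (ℕ.<⇒≤ (toℕ<n q)) (toℕ<n x) (toℕ<n y) e)
  ; rank-adjacent  = rank-adjacent
  }
  where
    rank-adjacent : ∀ {x y} → Adj (deleteEdge (C n) p q) x y
                  → offset n (toℕ q) (toℕ y) ≡ suc (offset n (toℕ q) (toℕ x))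
                  ⊎ offset n (toℕ q) (toℕ x) ≡ suc (offset n (toℕ q) (toℕ y))
    rank-adjacent {x} {y} e with Adj-deleteEdge⁻ (C n) e
    ... | adjacent cxy , ¬xy≡pq , ¬xy≡qp with cycleAdj⇒step {x = x} {y} cxy
    ... | inj₁ xy = inj₁ (cycleStep-offset pq xy ¬xy≡pq)
    ... | inj₂ yx = inj₂ (cycleStep-offset pq yx λ (y≡p , x≡q) → ¬xy≡qp (x≡q , y≡p))

cycle-deleteEdge-forest : ∀ {n} {u v : Fin n} → Adj (C n) u v → NoIsolated (deleteEdge (C n) u v)
                        → LinearForest (deleteEdge (C n) u v)
cycle-deleteEdge-forest {n} {u} {v} (adjacent e) legal = record
  { ranking    = ranking (cycleAdj⇒step {x = u} {v} e)
  ; symmetric  = deleteEdge-symmetric C-symmetric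
  ; edgesAlive = λ _ → refl
  ; noIsolated = legal
  }
  where
    ranking : CycleStep n u v ⊎ CycleStep n v u → PathRanking (deleteEdge (C n) u v)
    ranking (inj₁ uv) = cycle-deleteStep-ranking uv
    ranking (inj₂ vu) = pathRanking-⊆ (deleteEdge-comm-⊆ (C n)) (cycle-deleteStep-ranking vu)

C-threeInternal : ∀ m → ThreeDistinct (Internal (C (3 + m)))
C-threeInternal zero =
  0F , 1F , 2F ,
  internal {left = 1F} {2F} (adjacent refl) (adjacent refl) (λ ()) ,
  internal {left = 0F} {2F} (adjacent refl) (adjacent refl) (λ ()) ,
  internal {left = 0F} {1F} (adjacent refl) (adjacent refl) (λ ()) ,
  (λ ()) , (λ ()) , (λ ())
C-threeInternal (suc m) =
  1F , 2F , 3F ,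
  internal {left = 0F} {2F} (adjacent refl) (adjacent refl) (λ ()) ,
  internal {left = 1F} {3F} (adjacent refl) (adjacent refl) (λ ()) ,
  internal {left = 2F} {next m} (adjacent refl) (adjacent (adj-3-next m)) (2≢next m) ,
  (λ ()) , (λ ()) , (λ ())
  where
    next : ∀ m → Fin (4 + m)
    next zero    = 0F
    next (suc m) = 4F
    adj-3-next : ∀ m → cycleAdj (4 + m) 3F (next m) ≡ true
    adj-3-next zero    = refl
    adj-3-next (suc m) = refl
    2≢next : ∀ m → 2F ≢ next m
    2≢next zero    ()
    2≢next (suc m) ()

module _ (m : ℕ) where

  lastVertex : Fin (3 + m)
  lastVertex = fromℕ (2 + m)

  path : Graph (3 + m)
  path = deleteVertex (C (3 + m)) lastVertex

  path-noIsolated : NoIsolated path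
  path-noIsolated 0F       _       = 1F , refl
  path-noIsolated (fsuc x) alive-x =
    inject₁ x , Adj.present (Adj-deleteVertex⁺ (C (3 + m)) x~x′ x≢last x′≢last)
    where
      x≢last : fsuc x ≢ lastVertex
      x≢last = proj₂ (alive-deleteVertex⁻ (C (3 + m)) alive-x)
      x~x′ : Adj (C (3 + m)) (fsuc x) (inject₁ x)
      x~x′ = adjacent (step⇒cycleAdj (inj₂ (inj₁ (cong suc (toℕ-inject₁ x)))))
      x′≢last : inject₁ x ≢ lastVertex
      x′≢last x′≡last = toℕ-inject₁-≢ x (trans (sym (toℕ-fromℕ (2 + m))) (cong toℕ (sym x′≡last)))

  path-forest : LinearForest path
  path-forest = record
    { ranking    = pathRanking-⊆ path⊆cut (cycle-deleteStep-ranking last→0)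
    ; symmetric  = deleteVertex-symmetric {g = C (3 + m)} C-symmetric
    ; edgesAlive = deleteVertex-edgesAlive {g = C (3 + m)} λ _ → refl
    ; noIsolated = path-noIsolated
    }
    where
      last→0 : CycleStep (3 + m) lastVertex 0F
      last→0 = inj₂ (cong suc (toℕ-fromℕ (2 + m)) , refl)
      path⊆cut : path ⊆ deleteEdge (C (3 + m)) lastVertex 0F
      path⊆cut e = let (e′ , x≢last , y≢last) = Adj-deleteVertex⁻ (C (3 + m)) e
                   in  Adj-deleteEdge⁺ (C (3 + m)) e′ (x≢last ∘ proj₁) (y≢last ∘ proj₂)

independent? : ∀ {n} (g : Graph n) → Dec (∀ p q → ¬ (Internal g p × Internal g q × Adj g p q))
independent? g = all? λ p → all? λ q → ¬? (internal? g p ×-dec internal? g q ×-dec adj? g p q)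

-- path m is the path on m + 2 vertices; for m = 2 its two internal vertices are adjacent,
-- and Right wins by cutting the edge between them.
path-goodForLeft : ∀ m → m ≢ 2 → GoodForLeft (path m)
path-goodForLeft 0 _ = inj₂ λ ip iq e → toWitness {a? = independent? (path 0)} tt _ _ (ip , iq , e)
path-goodForLeft 1 _ = inj₂ λ ip iq e → toWitness {a? = independent? (path 1)} tt _ _ (ip , iq , e)
path-goodForLeft 2 m≢2 = contradiction refl m≢2
path-goodForLeft (suc (suc (suc m))) _ = inj₁ $
  1F , 2F , 3F ,
  internal {left = 0F} {2F} (adjacent refl) (adjacent refl) (λ ()) ,
  internal {left = 1F} {3F} (adjacent refl) (adjacent refl) (λ ()) ,
  internal {left = 2F} {4F} (adjacent refl) (adjacent refl) (λ ()) ,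
  (λ ()) , (λ ()) , (λ ())

theorem3p5 : (n : ℕ) → 3 ≤ n → n ≢ 5
    → LeftWinsLeftToMove (C n) × LeftWinsRightToMove (C n)
theorem3p5 (suc (suc (suc m))) (s≤s (s≤s (s≤s _))) n≢5 = leftFirst , rightFirst
  where
    leftFirst : LeftWinsLeftToMove (C (3 + m))
    leftFirst = leftMove (lastVertex m) refl (path-noIsolated m) $
      rightWins _ (ℕ.n<1+n _) (path-forest m) (path-goodForLeft m (n≢5 ∘ cong (3 +_)))
    rightFirst : LeftWinsRightToMove (C (3 + m))
    rightFirst = rightMoves λ u v e legal →
      leftWins _ (ℕ.n<1+n _) (cycle-deleteEdge-forest (adjacent e) legal)
        (threeInternal-deleteEdge (C-threeInternal m))
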